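{- For all positive integers $n,d,k$ with $n\ge d$, \[ H_{\mathrm{s}}(kn,kd) \ge \frac{H_{\mathrm{s}}(n,d)^k}{2^{k-1}}. \]
   Context: A pure simplicial complex of dimension $d-1$ on an $n$-element vertex set (e.g. $[n]$) is a nonempty family of $d$-element subsets (facets). Its adjacency graph has the facets as vertices, with $X,Y$ adjacent when $|X\setminus Y|=1$. The complex is strongly connected if this graph is connected; its diameter is the diameter of this graph. $H_{\mathrm{s}}(n,d)$ denotes the maximum diameter of strongly connected pure $(d-1)$-dimensional complexes on $n$ vertices. -}

module Defs where

open import Data.Nat using (ℕ; zero; suc; _≤_; _<_)
open import Data.Fin.Subset using (Subset; ∣_∣; _∩_; ∁)
open import Data.List using (List; _∷_)
open import Data.List.Relation.Unary.All using (All)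
open import Data.List.Membership.Propositional using (_∈_)
open import Data.Product using (Σ; ∃; ∃-syntax; _×_)
open import Relation.Binary.PropositionalEquality using (_≡_)
open import Relation.Nullary using (¬_)

-- A pure (d-1)-dimensional simplicial complex on vertex set Fin n:
-- a nonempty family (given as a list; only membership matters) of
-- d-element subsets of Fin n (the facets).
record PureComplex (n d : ℕ) : Set where
  constructor complex
  field
    facets    : List (Subset n)
    nonempty  : Σ (Subset n) (λ X → X ∈ facets)
    facetSize : All (λ X → ∣ X ∣ ≡ d) facets
open PureComplex public

Adjacent : {n : ℕ} → Subset n → Subset n → Set
Adjacent X Y = ∣ X ∩ ∁ Y ∣ ≡ 1

data Walk {n d : ℕ} (C : PureComplex n d) : Subset n → Subset n → ℕ → Set where
  here : ∀ {X} → X ∈ facets C → Walk C X X zero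
  step : ∀ {X Y Z ℓ} → X ∈ facets C → Adjacent X Y → Walk C Y Z ℓ → Walk C X Z (suc ℓ)

StronglyConnected : {n d : ℕ} → PureComplex n d → Set
StronglyConnected C = ∀ X Y → X ∈ facets C → Y ∈ facets C → ∃[ ℓ ] Walk C X Y ℓ

HasDiameter : {n d : ℕ} → PureComplex n d → ℕ → Set
HasDiameter C D =
  StronglyConnected C ×
  (∀ X Y → X ∈ facets C → Y ∈ facets C → ∃[ ℓ ] (ℓ ≤ D × Walk C X Y ℓ)) ×
  (∃[ X ] ∃[ Y ] (X ∈ facets C × Y ∈ facets C × (∀ ℓ → ℓ < D → ¬ Walk C X Y ℓ)))

-- h = H_s(n,d): h is the maximum diameter of strongly connected pure
-- (d-1)-dimensional complexes on n vertices (attained, and an upper bound).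
IsHs : ℕ → ℕ → ℕ → Set
IsHs n d h =
  (∃[ C ] HasDiameter {n} {d} C h) ×
  (∀ (C : PureComplex n d) D → HasDiameter C D → D ≤ h)

-- A shortest walk between two facets at distance h = H_s(n,d) is an induced path of length h
-- in the facet graph, and conversely the complex spanned by an induced path of length L has
-- diameter L. For induced paths β of length b and φ of length a, the facets β i ++ φ j are
-- adjacent exactly when (i , j) and (i′ , j′) are adjacent in the grid [0, b] × [0, a], so
-- induced paths of the grid lift to induced paths of facets. A snake using every other
-- column of the grid is induced and has length at least ab/2; taking the product with the
-- diametral path k − 1 times gives an induced path of length at least h ^ k / 2 ^ (k − 1)
-- in a (kd − 1)-dimensional complex on kn vertices.
module Submission where

open import Defs
open import Data.Bool using (Bool; true; false; not; if_then_else_)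
open import Data.Empty using (⊥-elim)
open import Data.Fin.Subset using (Subset; ∣_∣; _∩_; ∁)
open import Data.List using (applyUpTo)
open import Data.List.Membership.Propositional using (_∈_)
open import Data.List.Membership.Propositional.Properties using (∈-applyUpTo⁺; ∈-applyUpTo⁻)
open import Data.List.Relation.Unary.All using (lookup)
open import Data.List.Relation.Unary.All.Properties using (applyUpTo⁺₁)
open import Data.Nat
open import Data.Nat.Properties
open import Data.Nat.Tactic.RingSolver using (solve-∀)
open import Data.Product using (∃-syntax; _×_; _,_; proj₁; proj₂)
open import Data.Product.Properties using (,-injectiveˡ; ,-injectiveʳ)
open import Data.Sum using (_⊎_; inj₁; inj₂)
open import Data.Vec using ([]; _∷_; _++_)
open import Data.Vec.Properties using (++-injective)
open import Function using (_∘_)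
open import Relation.Binary.Definitions using (tri<; tri≈; tri>)
open import Relation.Binary.PropositionalEquality
open import Relation.Nullary using (¬_)

private
  variable
    m n d D L M a b h ℓ : ℕ

∣p∩∁p∣≡0 : (p : Subset m) → ∣ p ∩ ∁ p ∣ ≡ 0
∣p∩∁p∣≡0 []          = refl
∣p∩∁p∣≡0 (true ∷ p)  = ∣p∩∁p∣≡0 p
∣p∩∁p∣≡0 (false ∷ p) = ∣p∩∁p∣≡0 p

∣p∣+∣q∩∁p∣≡∣q∣+∣p∩∁q∣ : (p q : Subset m) → ∣ p ∣ + ∣ q ∩ ∁ p ∣ ≡ ∣ q ∣ + ∣ p ∩ ∁ q ∣
∣p∣+∣q∩∁p∣≡∣q∣+∣p∩∁q∣ []          []          = refl
∣p∣+∣q∩∁p∣≡∣q∣+∣p∩∁q∣ (true ∷ p)  (true ∷ q)  = cong suc (∣p∣+∣q∩∁p∣≡∣q∣+∣p∩∁q∣ p q)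
∣p∣+∣q∩∁p∣≡∣q∣+∣p∩∁q∣ (true ∷ p)  (false ∷ q) =
  trans (cong suc (∣p∣+∣q∩∁p∣≡∣q∣+∣p∩∁q∣ p q)) (sym (+-suc _ _))
∣p∣+∣q∩∁p∣≡∣q∣+∣p∩∁q∣ (false ∷ p) (true ∷ q)  =
  trans (+-suc _ _) (cong suc (∣p∣+∣q∩∁p∣≡∣q∣+∣p∩∁q∣ p q))
∣p∣+∣q∩∁p∣≡∣q∣+∣p∩∁q∣ (false ∷ p) (false ∷ q) = ∣p∣+∣q∩∁p∣≡∣q∣+∣p∩∁q∣ p q

∣p∩∁q∣≡∣q∩∁p∣ : (p q : Subset m) → ∣ p ∣ ≡ ∣ q ∣ → ∣ p ∩ ∁ q ∣ ≡ ∣ q ∩ ∁ p ∣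
∣p∩∁q∣≡∣q∩∁p∣ p q ∣p∣≡∣q∣ = sym (+-cancelˡ-≡ ∣ q ∣ _ _ (begin
  ∣ q ∣ + ∣ q ∩ ∁ p ∣ ≡⟨ cong (_+ ∣ q ∩ ∁ p ∣) ∣p∣≡∣q∣ ⟨
  ∣ p ∣ + ∣ q ∩ ∁ p ∣ ≡⟨ ∣p∣+∣q∩∁p∣≡∣q∣+∣p∩∁q∣ p q ⟩
  ∣ q ∣ + ∣ p ∩ ∁ q ∣ ∎))
  where open ≡-Reasoning

Adjacent-sym : (X Y : Subset m) → ∣ X ∣ ≡ ∣ Y ∣ → Adjacent X Y → Adjacent Y X
Adjacent-sym X Y ∣X∣≡∣Y∣ X∼Y = trans (sym (∣p∩∁q∣≡∣q∩∁p∣ X Y ∣X∣≡∣Y∣)) X∼Y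

∣p∩∁q∣≡0⇒p≡q : (p q : Subset m) → ∣ p ∣ ≡ ∣ q ∣ → ∣ p ∩ ∁ q ∣ ≡ 0 → p ≡ q
∣p∩∁q∣≡0⇒p≡q p q ∣p∣≡∣q∣ p⊆q = both-empty p q p⊆q (trans (sym (∣p∩∁q∣≡∣q∩∁p∣ p q ∣p∣≡∣q∣)) p⊆q)
  where
  both-empty : (p q : Subset m) → ∣ p ∩ ∁ q ∣ ≡ 0 → ∣ q ∩ ∁ p ∣ ≡ 0 → p ≡ q
  both-empty []          []          _  _  = refl
  both-empty (true ∷ p)  (true ∷ q)  pq qp = cong (true ∷_) (both-empty p q pq qp)
  both-empty (false ∷ p) (false ∷ q) pq qp = cong (false ∷_) (both-empty p q pq qp)

∣p++q∣≡∣p∣+∣q∣ : (p : Subset m) (q : Subset n) → ∣ p ++ q ∣ ≡ ∣ p ∣ + ∣ q ∣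
∣p++q∣≡∣p∣+∣q∣ []          q = refl
∣p++q∣≡∣p∣+∣q∣ (true ∷ p)  q = cong suc (∣p++q∣≡∣p∣+∣q∣ p q)
∣p++q∣≡∣p∣+∣q∣ (false ∷ p) q = ∣p++q∣≡∣p∣+∣q∣ p q

∣p++q∩∁[r++s]∣≡∣p∩∁r∣+∣q∩∁s∣ : (p r : Subset m) (q s : Subset n) →
  ∣ (p ++ q) ∩ ∁ (r ++ s) ∣ ≡ ∣ p ∩ ∁ r ∣ + ∣ q ∩ ∁ s ∣
∣p++q∩∁[r++s]∣≡∣p∩∁r∣+∣q∩∁s∣ []          []          q s = refl
∣p++q∩∁[r++s]∣≡∣p∩∁r∣+∣q∩∁s∣ (true ∷ p)  (true ∷ r)  q s = ∣p++q∩∁[r++s]∣≡∣p∩∁r∣+∣q∩∁s∣ p r q s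
∣p++q∩∁[r++s]∣≡∣p∩∁r∣+∣q∩∁s∣ (true ∷ p)  (false ∷ r) q s = cong suc (∣p++q∩∁[r++s]∣≡∣p∩∁r∣+∣q∩∁s∣ p r q s)
∣p++q∩∁[r++s]∣≡∣p∩∁r∣+∣q∩∁s∣ (false ∷ p) (true ∷ r)  q s = ∣p++q∩∁[r++s]∣≡∣p∩∁r∣+∣q∩∁s∣ p r q s
∣p++q∩∁[r++s]∣≡∣p∩∁r∣+∣q∩∁s∣ (false ∷ p) (false ∷ r) q s = ∣p++q∩∁[r++s]∣≡∣p∩∁r∣+∣q∩∁s∣ p r q s

Consecutive : ℕ → ℕ → Set
Consecutive i j = j ≡ suc i ⊎ i ≡ suc j

Consecutive-sym : ∀ {i j} → Consecutive i j → Consecutive j i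
Consecutive-sym (inj₁ j≡1+i) = inj₂ j≡1+i
Consecutive-sym (inj₂ i≡1+j) = inj₁ i≡1+j

Consecutive-irrefl : ∀ {i} → ¬ Consecutive i i
Consecutive-irrefl (inj₁ i≡1+i) = 1+n≢n (sym i≡1+i)
Consecutive-irrefl (inj₂ i≡1+i) = 1+n≢n (sym i≡1+i)

Consecutive⇒≤1+ : ∀ {i j} → Consecutive i j → j ≤ suc i
Consecutive⇒≤1+ (inj₁ refl) = ≤-refl
Consecutive⇒≤1+ (inj₂ refl) = m≤n⇒m≤1+n (n≤1+n _)

Consecutive-+ʳ : ∀ {i j} k → Consecutive i j → Consecutive (i + k) (j + k)
Consecutive-+ʳ k (inj₁ refl) = inj₁ refl
Consecutive-+ʳ k (inj₂ refl) = inj₂ refl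

GridAdjacent : ℕ × ℕ → ℕ × ℕ → Set
GridAdjacent (i , j) (i′ , j′) = (Consecutive i i′ × j ≡ j′) ⊎ (i ≡ i′ × Consecutive j j′)

record IsInducedPath {A : Set} (_∼_ : A → A → Set) (L : ℕ) (g : ℕ → A) : Set where
  field
    adjacent             : ∀ {i} → i < L → g i ∼ g (suc i)
    adjacent⇒consecutive : ∀ {i j} → i ≤ L → j ≤ L → g i ∼ g j → Consecutive i j
    injective            : ∀ {i j} → i ≤ L → j ≤ L → g i ≡ g j → i ≡ j

record FacetPath (n d L : ℕ) (g : ℕ → Subset n) : Set where
  field
    size          : ∀ {i} → i ≤ L → ∣ g i ∣ ≡ d
    isInducedPath : IsInducedPath Adjacent L g

  open IsInducedPath isInducedPath public

  consecutive⇒adjacent : ∀ {i j} → i ≤ L → j ≤ L → Consecutive i j → Adjacent (g i) (g j)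
  consecutive⇒adjacent i≤L j≤L (inj₁ refl) = adjacent j≤L
  consecutive⇒adjacent {j = j} i≤L j≤L (inj₂ refl) =
    Adjacent-sym (g j) (g (suc j)) (trans (size j≤L) (sym (size i≤L))) (adjacent i≤L)

module _ {C : PureComplex n d} where

  source-∈ : ∀ {X Z} → Walk C X Z ℓ → X ∈ facets C
  source-∈ (here X∈C)     = X∈C
  source-∈ (step X∈C _ _) = X∈C

  _++ʷ_ : ∀ {X Y Z k} → Walk C X Y k → Walk C Y Z ℓ → Walk C X Z (k + ℓ)
  here _         ++ʷ v = v
  step X∈C X∼Y w ++ʷ v = step X∈C X∼Y (w ++ʷ v)

  -- The i-th facet of a walk; past the end it stays at the target.
  vertex : ∀ {X Z} → Walk C X Z ℓ → ℕ → Subset n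
  vertex {X = X} (here _)     _       = X
  vertex {X = X} (step _ _ _) zero    = X
  vertex         (step _ _ w) (suc i) = vertex w i

  vertex-zero : ∀ {X Z} (w : Walk C X Z ℓ) → vertex w 0 ≡ X
  vertex-zero (here _)     = refl
  vertex-zero (step _ _ _) = refl

  vertex-∈ : ∀ {X Z} (w : Walk C X Z ℓ) i → vertex w i ∈ facets C
  vertex-∈ (here X∈C)     _       = X∈C
  vertex-∈ (step X∈C _ _) zero    = X∈C
  vertex-∈ (step _ _ w)   (suc i) = vertex-∈ w i

  vertex-adjacent : ∀ {X Z} (w : Walk C X Z ℓ) {i} → i < ℓ → Adjacent (vertex w i) (vertex w (suc i))
  vertex-adjacent (step {X} _ X∼Y w) {zero}  _         = subst (Adjacent X) (sym (vertex-zero w)) X∼Y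
  vertex-adjacent (step _ _ w)       {suc i} (s≤s i<ℓ) = vertex-adjacent w i<ℓ

  drop : ∀ {X Z} (w : Walk C X Z ℓ) j → Walk C (vertex w j) Z (ℓ ∸ j)
  drop (here X∈C)     zero    = here X∈C
  drop (here X∈C)     (suc _) = here X∈C
  drop w@(step _ _ _) zero    = w
  drop (step _ _ w)   (suc j) = drop w j

  take-++ʷ : ∀ {X Z k} (w : Walk C X Z ℓ) i → i ≤ ℓ → Walk C (vertex w i) Z k → Walk C X Z (i + k)
  take-++ʷ (here _)         zero    _         v = v
  take-++ʷ (step _ _ _)     zero    _         v = v
  take-++ʷ (step X∈C X∼Y w) (suc i) (s≤s i≤ℓ) v = step X∈C X∼Y (take-++ʷ w i i≤ℓ v)

  Shortest : Subset n → Subset n → ℕ → Set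
  Shortest X Z ℓ = ∀ ℓ′ → ℓ′ < ℓ → ¬ Walk C X Z ℓ′

  -- Replacing the segment of w between positions i and j by v gives a walk from X to Z.
  shortest-segment : ∀ {X Z i j k} → Shortest X Z ℓ → (w : Walk C X Z ℓ) → i ≤ j → j ≤ ℓ →
    Walk C (vertex w i) (vertex w j) k → j ≤ k + i
  shortest-segment {ℓ = ℓ} {i = i} {j} {k} shortest w i≤j j≤ℓ v =
    +-cancelʳ-≤ (ℓ ∸ j) j (k + i) (begin
      j + (ℓ ∸ j)       ≡⟨ m+[n∸m]≡n j≤ℓ ⟩
      ℓ                 ≤⟨ ≮⇒≥ (λ shorter → shortest _ shorter rerouted) ⟩
      i + (k + (ℓ ∸ j)) ≡⟨ rearrange i k (ℓ ∸ j) ⟩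
      k + i + (ℓ ∸ j)   ∎)
    where
    open ≤-Reasoning
    rerouted : Walk C _ _ (i + (k + (ℓ ∸ j)))
    rerouted = take-++ʷ w i (≤-trans i≤j j≤ℓ) (v ++ʷ drop w j)
    rearrange : ∀ x y z → x + (y + z) ≡ y + x + z
    rearrange = solve-∀

  shortest-induced : ∀ {X Z} → Shortest X Z ℓ → (w : Walk C X Z ℓ) → FacetPath n d ℓ (vertex w)
  shortest-induced {ℓ = ℓ} shortest w = record
    { size          = λ _ → sized _
    ; isInducedPath = record
      { adjacent             = vertex-adjacent w
      ; adjacent⇒consecutive = adjacent⇒consecutive
      ; injective            = injective
      }
    }
    where
    sized : ∀ i → ∣ vertex w i ∣ ≡ d
    sized i = lookup (facetSize C) (vertex-∈ w i)

    no-repeat : ∀ {i j} → i < j → j ≤ ℓ → vertex w i ≢ vertex w j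
    no-repeat {i} i<j j≤ℓ wᵢ≡wⱼ = <⇒≱ i<j
      (shortest-segment shortest w (<⇒≤ i<j) j≤ℓ
        (subst (λ Y → Walk C (vertex w i) Y 0) wᵢ≡wⱼ (here (vertex-∈ w i))))

    forward : ∀ {i j} → i < j → j ≤ ℓ → Adjacent (vertex w i) (vertex w j) → j ≡ suc i
    forward {i} {j} i<j j≤ℓ wᵢ∼wⱼ = ≤-antisym
      (shortest-segment shortest w (<⇒≤ i<j) j≤ℓ (step (vertex-∈ w i) wᵢ∼wⱼ (here (vertex-∈ w j))))
      i<j

    adjacent⇒consecutive : ∀ {i j} → i ≤ ℓ → j ≤ ℓ → Adjacent (vertex w i) (vertex w j) → Consecutive i j
    adjacent⇒consecutive {i} {j} i≤ℓ j≤ℓ wᵢ∼wⱼ with <-cmp i j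
    ... | tri< i<j _ _ = inj₁ (forward i<j j≤ℓ wᵢ∼wⱼ)
    ... | tri≈ _ refl _ = ⊥-elim (0≢1+n (trans (sym (∣p∩∁p∣≡0 (vertex w i))) wᵢ∼wⱼ))
    ... | tri> _ _ j<i = inj₂ (forward j<i i≤ℓ
      (Adjacent-sym (vertex w i) (vertex w j) (trans (sized i) (sym (sized j))) wᵢ∼wⱼ))

    injective : ∀ {i j} → i ≤ ℓ → j ≤ ℓ → vertex w i ≡ vertex w j → i ≡ j
    injective {i} {j} i≤ℓ j≤ℓ wᵢ≡wⱼ with <-cmp i j
    ... | tri< i<j _ _ = ⊥-elim (no-repeat i<j j≤ℓ wᵢ≡wⱼ)
    ... | tri≈ _ i≡j _ = i≡j
    ... | tri> _ _ j<i = ⊥-elim (no-repeat j<i i≤ℓ (sym wᵢ≡wⱼ))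

diametralPath : {C : PureComplex n d} → HasDiameter C D → ∃[ β ] FacetPath n d D β
diametralPath (_ , bounded , X , Z , X∈C , Z∈C , shortest) with bounded X Z X∈C Z∈C
... | ℓ , ℓ≤D , w with m≤n⇒m<n∨m≡n ℓ≤D
...   | inj₁ ℓ<D = ⊥-elim (shortest ℓ ℓ<D w)
...   | inj₂ refl = vertex w , shortest-induced shortest w

module _ {g : ℕ → Subset n} (P : FacetPath n d L g) where

  open FacetPath P

  pathComplex : PureComplex n d
  pathComplex = complex (applyUpTo g (suc L)) (g 0 , ∈-applyUpTo⁺ g z<s)
    (applyUpTo⁺₁ g (suc L) (λ i<1+L → size (≤-pred i<1+L)))

  private
    ∈-path⁺ : ∀ {i} → i ≤ L → g i ∈ facets pathComplex
    ∈-path⁺ i≤L = ∈-applyUpTo⁺ g (s≤s i≤L)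

    ∈-path⁻ : ∀ {X} → X ∈ facets pathComplex → ∃[ i ] (i ≤ L × X ≡ g i)
    ∈-path⁻ X∈C with ∈-applyUpTo⁻ g X∈C
    ... | i , i<1+L , X≡gᵢ = i , ≤-pred i<1+L , X≡gᵢ

    walk-up : ∀ k i → k + i ≤ L → Walk pathComplex (g i) (g (k + i)) k
    walk-up zero    i i≤L   = here (∈-path⁺ i≤L)
    walk-up (suc k) i k+i<L =
      step (∈-path⁺ (≤-trans (m≤n+m i (suc k)) k+i<L)) (adjacent (≤-trans (s≤s (m≤n+m i k)) k+i<L))
        (subst (λ j → Walk pathComplex (g (suc i)) (g j) k) (+-suc k i)
          (walk-up k (suc i) (subst (_≤ L) (sym (+-suc k i)) k+i<L)))

    walk-down : ∀ k i → k + i ≤ L → Walk pathComplex (g (k + i)) (g i) k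
    walk-down zero    i i≤L   = here (∈-path⁺ i≤L)
    walk-down (suc k) i k+i<L =
      step (∈-path⁺ k+i<L) (consecutive⇒adjacent k+i<L (<⇒≤ k+i<L) (inj₂ refl))
        (walk-down k i (<⇒≤ k+i<L))

    walk-between : ∀ {i j} → i ≤ L → j ≤ L → ∃[ ℓ ] (ℓ ≤ L × Walk pathComplex (g i) (g j) ℓ)
    walk-between {i} {j} i≤L j≤L with ≤-total i j
    ... | inj₁ i≤j = j ∸ i , ≤-trans (m∸n≤m j i) j≤L ,
      subst (λ k → Walk pathComplex (g i) (g k) (j ∸ i)) (m∸n+n≡m i≤j)
        (walk-up (j ∸ i) i (subst (_≤ L) (sym (m∸n+n≡m i≤j)) j≤L))
    ... | inj₂ j≤i = i ∸ j , ≤-trans (m∸n≤m i j) i≤L ,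
      subst (λ k → Walk pathComplex (g k) (g j) (i ∸ j)) (m∸n+n≡m j≤i)
        (walk-down (i ∸ j) j (subst (_≤ L) (sym (m∸n+n≡m j≤i)) i≤L))

    walk-length : ∀ {X Z i j} → Walk pathComplex X Z ℓ → i ≤ L → j ≤ L → X ≡ g i → Z ≡ g j →
      j ≤ ℓ + i
    walk-length (here _) i≤L j≤L refl gᵢ≡gⱼ = ≤-reflexive (injective j≤L i≤L (sym gᵢ≡gⱼ))
    walk-length {i = i} {j} (step {ℓ = ℓ} _ X∼Y w) i≤L j≤L refl Z≡gⱼ with ∈-path⁻ (source-∈ w)
    ... | i′ , i′≤L , refl = begin
      j           ≤⟨ walk-length w i′≤L j≤L refl Z≡gⱼ ⟩
      ℓ + i′      ≤⟨ +-monoʳ-≤ ℓ (Consecutive⇒≤1+ (adjacent⇒consecutive i≤L i′≤L X∼Y)) ⟩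
      ℓ + suc i   ≡⟨ +-suc ℓ i ⟩
      suc ℓ + i   ∎
      where open ≤-Reasoning

  pathComplex-diameter : HasDiameter pathComplex L
  pathComplex-diameter = connected , bounded , g 0 , g L , ∈-path⁺ z≤n , ∈-path⁺ ≤-refl , shortest
    where
    bounded : ∀ X Y → X ∈ facets pathComplex → Y ∈ facets pathComplex →
      ∃[ ℓ ] (ℓ ≤ L × Walk pathComplex X Y ℓ)
    bounded X Y X∈C Y∈C with ∈-path⁻ X∈C | ∈-path⁻ Y∈C
    ... | i , i≤L , refl | j , j≤L , refl = walk-between i≤L j≤L

    connected : StronglyConnected pathComplex
    connected X Y X∈C Y∈C with bounded X Y X∈C Y∈C
    ... | ℓ , _ , w = ℓ , w

    shortest : ∀ ℓ → ℓ < L → ¬ Walk pathComplex (g 0) (g L) ℓ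
    shortest ℓ ℓ<L w = <⇒≱ ℓ<L (subst (L ≤_) (+-identityʳ ℓ) (walk-length w z≤n ≤-refl refl refl))

module _ {β : ℕ → Subset n} {φ : ℕ → Subset M} (B : FacetPath n d b β) (F : FacetPath M D a φ) where

  private
    module B = FacetPath B
    module F = FacetPath F

  InGrid : ℕ × ℕ → Set
  InGrid (i , j) = i ≤ b × j ≤ a

  lift : ℕ × ℕ → Subset (n + M)
  lift (i , j) = β i ++ φ j

  private
    ∣lift∩∁lift∣ : ∀ p q →
      ∣ lift p ∩ ∁ (lift q) ∣ ≡ ∣ β (proj₁ p) ∩ ∁ (β (proj₁ q)) ∣ + ∣ φ (proj₂ p) ∩ ∁ (φ (proj₂ q)) ∣
    ∣lift∩∁lift∣ (i , j) (i′ , j′) = ∣p++q∩∁[r++s]∣≡∣p∩∁r∣+∣q∩∁s∣ (β i) (β i′) (φ j) (φ j′)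

    m+n≡1⇒ : ∀ x y → x + y ≡ 1 → (x ≡ 1 × y ≡ 0) ⊎ (x ≡ 0 × y ≡ 1)
    m+n≡1⇒ zero          y    x+y≡1 = inj₂ (refl , x+y≡1)
    m+n≡1⇒ (suc zero)    zero _     = inj₁ (refl , refl)

    β-injective : ∀ {i i′} → i ≤ b → i′ ≤ b → ∣ β i ∩ ∁ (β i′) ∣ ≡ 0 → i ≡ i′
    β-injective i≤b i′≤b ∣βᵢ∩∁βᵢ′∣≡0 = B.injective i≤b i′≤b
      (∣p∩∁q∣≡0⇒p≡q _ _ (trans (B.size i≤b) (sym (B.size i′≤b))) ∣βᵢ∩∁βᵢ′∣≡0)

    φ-injective : ∀ {j j′} → j ≤ a → j′ ≤ a → ∣ φ j ∩ ∁ (φ j′) ∣ ≡ 0 → j ≡ j′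
    φ-injective j≤a j′≤a ∣φⱼ∩∁φⱼ′∣≡0 = F.injective j≤a j′≤a
      (∣p∩∁q∣≡0⇒p≡q _ _ (trans (F.size j≤a) (sym (F.size j′≤a))) ∣φⱼ∩∁φⱼ′∣≡0)

  lift-adjacent : ∀ {p q} → InGrid p → InGrid q → GridAdjacent p q → Adjacent (lift p) (lift q)
  lift-adjacent {i , j} {i′ , j′} (i≤b , j≤a) (i′≤b , j′≤a) (inj₁ (i~i′ , refl)) =
    trans (∣lift∩∁lift∣ (i , j) (i′ , j))
      (cong₂ _+_ (B.consecutive⇒adjacent i≤b i′≤b i~i′) (∣p∩∁p∣≡0 (φ j)))
  lift-adjacent {i , j} {i′ , j′} (i≤b , j≤a) (i′≤b , j′≤a) (inj₂ (refl , j~j′)) =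
    trans (∣lift∩∁lift∣ (i , j) (i , j′))
      (cong₂ _+_ (∣p∩∁p∣≡0 (β i)) (F.consecutive⇒adjacent j≤a j′≤a j~j′))

  lift-adjacent⁻ : ∀ {p q} → InGrid p → InGrid q → Adjacent (lift p) (lift q) → GridAdjacent p q
  lift-adjacent⁻ {p} {q} (i≤b , j≤a) (i′≤b , j′≤a) lift∼lift
    with m+n≡1⇒ _ _ (trans (sym (∣lift∩∁lift∣ p q)) lift∼lift)
  ... | inj₁ (βᵢ∼βᵢ′ , φⱼ⊆φⱼ′) =
    inj₁ (B.adjacent⇒consecutive i≤b i′≤b βᵢ∼βᵢ′ , φ-injective j≤a j′≤a φⱼ⊆φⱼ′)
  ... | inj₂ (βᵢ⊆βᵢ′ , φⱼ∼φⱼ′) =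
    inj₂ (β-injective i≤b i′≤b βᵢ⊆βᵢ′ , F.adjacent⇒consecutive j≤a j′≤a φⱼ∼φⱼ′)

  lift-injective : ∀ {p q} → InGrid p → InGrid q → lift p ≡ lift q → p ≡ q
  lift-injective {i , j} {i′ , j′} (i≤b , j≤a) (i′≤b , j′≤a) βᵢφⱼ≡βᵢ′φⱼ′
    with ++-injective (β i) (β i′) βᵢφⱼ≡βᵢ′φⱼ′
  ... | βᵢ≡βᵢ′ , φⱼ≡φⱼ′ = cong₂ _,_ (B.injective i≤b i′≤b βᵢ≡βᵢ′) (F.injective j≤a j′≤a φⱼ≡φⱼ′)

  lift-path : ∀ {σ} → IsInducedPath GridAdjacent L σ → (∀ {t} → t ≤ L → InGrid (σ t)) →
    FacetPath (n + M) (d + D) L (lift ∘ σ)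
  lift-path {σ = σ} S inGrid = record
    { size          = λ t≤L → size (inGrid t≤L)
    ; isInducedPath = record
      { adjacent             = λ t<L → lift-adjacent (inGrid (<⇒≤ t<L)) (inGrid t<L) (S.adjacent t<L)
      ; adjacent⇒consecutive = λ s≤L t≤L lift∼lift →
          S.adjacent⇒consecutive s≤L t≤L (lift-adjacent⁻ (inGrid s≤L) (inGrid t≤L) lift∼lift)
      ; injective            = λ s≤L t≤L lift≡lift →
          S.injective s≤L t≤L (lift-injective (inGrid s≤L) (inGrid t≤L) lift≡lift)
      }
    }
    where
    module S = IsInducedPath S
    size : ∀ {p} → InGrid p → ∣ lift p ∣ ≡ d + D
    size {i , j} (i≤b , j≤a) = trans (∣p++q∣≡∣p∣+∣q∣ (β i) (φ j)) (cong₂ _+_ (B.size i≤b) (F.size j≤a))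

-- The snake runs through the columns 2c of the strip [0, b] × ℕ, upwards for even c and
-- downwards for odd c, passing from column 2c to 2c + 2 through a single bridge cell in
-- column 2c + 1; the single bridge is what keeps the path induced.
module Snake (b : ℕ) where

  upward : ℕ → Bool
  upward zero    = true
  upward (suc c) = not (upward c)

  level : ℕ → ℕ → ℕ
  level c r = if upward c then r else b ∸ r

  level-≤ : ∀ c {r} → r ≤ b → level c r ≤ b
  level-≤ c {r} r≤b with upward c
  ... | true  = r≤b
  ... | false = m∸n≤m b r

  level-injective : ∀ c {r r′} → r ≤ b → r′ ≤ b → level c r ≡ level c r′ → r ≡ r′
  level-injective c r≤b r′≤b eq with upward c
  ... | true  = eq
  ... | false = ∸-cancelˡ-≡ r≤b r′≤b eq

  level-consecutive⁻ : ∀ c {r r′} → r ≤ b → r′ ≤ b →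
    Consecutive (level c r) (level c r′) → Consecutive r r′
  level-consecutive⁻ c {r} {r′} r≤b r′≤b r~r′ with upward c
  ... | true  = r~r′
  ... | false = Consecutive-sym (reflect r~r′)
    where
    reflect⁺ : ∀ {r r′} → r ≤ b → r′ ≤ b → b ∸ r′ ≡ suc (b ∸ r) → r ≡ suc r′
    reflect⁺ {r} {r′} r≤b r′≤b eq = +-cancelʳ-≡ (b ∸ r) r (suc r′) (begin
      r + (b ∸ r)        ≡⟨ m+[n∸m]≡n r≤b ⟩
      b                  ≡⟨ m+[n∸m]≡n r′≤b ⟨
      r′ + (b ∸ r′)      ≡⟨ cong (r′ +_) eq ⟩
      r′ + suc (b ∸ r)   ≡⟨ +-suc r′ (b ∸ r) ⟩
      suc r′ + (b ∸ r)   ∎)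
      where open ≡-Reasoning
    reflect : Consecutive (b ∸ r) (b ∸ r′) → Consecutive r′ r
    reflect (inj₁ eq) = inj₁ (reflect⁺ r≤b r′≤b eq)
    reflect (inj₂ eq) = inj₂ (reflect⁺ r′≤b r≤b eq)

  level-turn : ∀ c → level c b ≡ level (suc c) 0
  level-turn c with upward c
  ... | true  = refl
  ... | false = n∸n≡0 b

  level-step : ∀ c {r} → r < b → Consecutive (level c r) (level c (suc r))
  level-step c r<b with upward c
  ... | true  = inj₁ refl
  ... | false = inj₂ (+-∸-assoc 1 r<b)

  data Cell : Set where
    column : (c r : ℕ) → r ≤ b → Cell
    bridge : ℕ → Cell

  position : Cell → ℕ × ℕ
  position (column c r _) = level c r , 2 * c
  position (bridge c)     = level c b , suc (2 * c)

  index : Cell → ℕ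
  index (column c r _) = r + c * (2 + b)
  index (bridge c)     = suc b + c * (2 + b)

  next : Cell → Cell
  next (column c r r≤b) with m≤n⇒m<n∨m≡n r≤b
  ... | inj₁ r<b = column c (suc r) r<b
  ... | inj₂ _   = bridge c
  next (bridge c) = column (suc c) 0 z≤n

  index-next : ∀ p → index (next p) ≡ suc (index p)
  index-next (column c r r≤b) with m≤n⇒m<n∨m≡n r≤b
  ... | inj₁ _    = refl
  ... | inj₂ refl = refl
  index-next (bridge c) = refl

  next-adjacent : ∀ p → GridAdjacent (position p) (position (next p))
  next-adjacent (column c r r≤b) with m≤n⇒m<n∨m≡n r≤b
  ... | inj₁ r<b  = inj₁ (level-step c r<b , refl)
  ... | inj₂ refl = inj₂ (refl , inj₁ refl)
  next-adjacent (bridge c) = inj₂ (level-turn c , inj₁ (*-suc 2 c))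

  private
    double-injective : ∀ c c′ → 2 * c ≡ 2 * c′ → c ≡ c′
    double-injective c c′ = *-cancelˡ-≡ c c′ 2

    column-bridge : ∀ c r c′ → r ≤ b → level c r ≡ level c′ b → Consecutive (2 * c) (suc (2 * c′)) →
      Consecutive (r + c * (2 + b)) (suc b + c′ * (2 + b))
    column-bridge c r c′ r≤b same-level (inj₁ c′≡c) with double-injective c′ c (suc-injective c′≡c)
    ... | refl with level-injective c r≤b ≤-refl same-level
    ...   | refl = inj₁ refl
    column-bridge c r c′ r≤b same-level (inj₂ c≡2+c′)
      with double-injective c (suc c′) (trans c≡2+c′ (sym (*-suc 2 c′)))
    ... | refl with level-injective (suc c′) r≤b z≤n (trans same-level (level-turn c′))
    ...   | refl = inj₂ refl

  position-adjacent⇒consecutive : ∀ p q → GridAdjacent (position p) (position q) →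
    Consecutive (index p) (index q)
  position-adjacent⇒consecutive (column c r r≤b) (column c′ r′ r′≤b) (inj₁ (r~r′ , c≡c′))
    with double-injective c c′ c≡c′
  ... | refl = Consecutive-+ʳ (c * (2 + b)) (level-consecutive⁻ c r≤b r′≤b r~r′)
  position-adjacent⇒consecutive (column c _ _) (column c′ _ _) (inj₂ (_ , inj₁ eq)) =
    ⊥-elim (even≢odd c′ c eq)
  position-adjacent⇒consecutive (column c _ _) (column c′ _ _) (inj₂ (_ , inj₂ eq)) =
    ⊥-elim (even≢odd c c′ eq)
  position-adjacent⇒consecutive (column c _ _) (bridge c′) (inj₁ (_ , eq)) = ⊥-elim (even≢odd c c′ eq)
  position-adjacent⇒consecutive (column c r r≤b) (bridge c′) (inj₂ (same-level , c~c′)) =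
    column-bridge c r c′ r≤b same-level c~c′
  position-adjacent⇒consecutive (bridge c) (column c′ _ _) (inj₁ (_ , eq)) = ⊥-elim (even≢odd c′ c (sym eq))
  position-adjacent⇒consecutive (bridge c) (column c′ r′ r′≤b) (inj₂ (same-level , c~c′)) =
    Consecutive-sym (column-bridge c′ r′ c r′≤b (sym same-level) (Consecutive-sym c~c′))
  position-adjacent⇒consecutive (bridge c) (bridge c′) (inj₁ (b~b , c≡c′))
    with double-injective c c′ (suc-injective c≡c′)
  ... | refl = ⊥-elim (Consecutive-irrefl b~b)
  position-adjacent⇒consecutive (bridge c) (bridge c′) (inj₂ (_ , inj₁ eq)) =
    ⊥-elim (even≢odd c′ c (suc-injective eq))
  position-adjacent⇒consecutive (bridge c) (bridge c′) (inj₂ (_ , inj₂ eq)) =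
    ⊥-elim (even≢odd c c′ (suc-injective eq))

  position-injective : ∀ p q → position p ≡ position q → index p ≡ index q
  position-injective (column c r r≤b) (column c′ r′ r′≤b) eq with double-injective c c′ (,-injectiveʳ eq)
  ... | refl with level-injective c r≤b r′≤b (,-injectiveˡ eq)
  ...   | refl = refl
  position-injective (column c _ _) (bridge c′) eq = ⊥-elim (even≢odd c c′ (,-injectiveʳ eq))
  position-injective (bridge c) (column c′ _ _) eq = ⊥-elim (even≢odd c′ c (sym (,-injectiveʳ eq)))
  position-injective (bridge c) (bridge c′) eq with double-injective c c′ (suc-injective (,-injectiveʳ eq))
  ... | refl = refl

  position-inGrid : ∀ m p → index p ≤ b + m * (2 + b) →
    proj₁ (position p) ≤ b × proj₂ (position p) ≤ 2 * m
  position-inGrid m (column c r r≤b) r+c[2+b]≤L = level-≤ c r≤b , *-monoʳ-≤ 2 (≤-pred c<1+m)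
    where
    open ≤-Reasoning
    c<1+m : c < suc m
    c<1+m = *-cancelʳ-< (2 + b) c (suc m) (begin-strict
      c * (2 + b)       ≤⟨ m≤n+m _ r ⟩
      r + c * (2 + b)   ≤⟨ r+c[2+b]≤L ⟩
      b + m * (2 + b)   <⟨ +-monoˡ-< (m * (2 + b)) (≤-trans (n<1+n b) (n≤1+n _)) ⟩
      suc m * (2 + b)   ∎)
  position-inGrid m (bridge c) 1+b+c[2+b]≤L =
    level-≤ c ≤-refl , ≤-trans (n≤1+n _) (subst (_≤ 2 * m) (*-suc 2 c) (*-monoʳ-≤ 2 c<m))
    where
    c<m : c < m
    c<m = *-cancelʳ-< (2 + b) c m (+-cancelˡ-< b _ _ 1+b+c[2+b]≤L)

  cell : ℕ → Cell
  cell zero    = column 0 0 z≤n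
  cell (suc t) = next (cell t)

  index-cell : ∀ t → index (cell t) ≡ t
  index-cell zero    = refl
  index-cell (suc t) = trans (index-next (cell t)) (cong suc (index-cell t))

  snake : ℕ → ℕ × ℕ
  snake = position ∘ cell

  snake-induced : ∀ L → IsInducedPath GridAdjacent L snake
  snake-induced L = record
    { adjacent             = λ {t} _ → next-adjacent (cell t)
    ; adjacent⇒consecutive = λ {s} {t} _ _ snakeₛ∼snakeₜ →
        subst₂ Consecutive (index-cell s) (index-cell t)
          (position-adjacent⇒consecutive (cell s) (cell t) snakeₛ∼snakeₜ)
    ; injective            = λ {s} {t} _ _ snakeₛ≡snakeₜ → begin
        s                ≡⟨ index-cell s ⟨
        index (cell s)   ≡⟨ position-injective (cell s) (cell t) snakeₛ≡snakeₜ ⟩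
        index (cell t)   ≡⟨ index-cell t ⟩
        t                ∎
    }
    where open ≡-Reasoning

  snake-inGrid : ∀ m {t} → t ≤ b + m * (2 + b) → proj₁ (snake t) ≤ b × proj₂ (snake t) ≤ 2 * m
  snake-inGrid m {t} t≤L =
    position-inGrid m (cell t) (subst (_≤ b + m * (2 + b)) (sym (index-cell t)) t≤L)

2*⌊n/2⌋≤n : ∀ n → 2 * ⌊ n /2⌋ ≤ n
2*⌊n/2⌋≤n n = begin
  ⌊ n /2⌋ + (⌊ n /2⌋ + 0) ≡⟨ cong (⌊ n /2⌋ +_) (+-identityʳ ⌊ n /2⌋) ⟩
  ⌊ n /2⌋ + ⌊ n /2⌋       ≤⟨ +-monoʳ-≤ ⌊ n /2⌋ (⌊n/2⌋≤⌈n/2⌉ n) ⟩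
  ⌊ n /2⌋ + ⌈ n /2⌉       ≡⟨ ⌊n/2⌋+⌈n/2⌉≡n n ⟩
  n                       ∎
  where open ≤-Reasoning

n≤1+2*⌊n/2⌋ : ∀ n → n ≤ suc (2 * ⌊ n /2⌋)
n≤1+2*⌊n/2⌋ zero          = z≤n
n≤1+2*⌊n/2⌋ (suc zero)    = ≤-refl
n≤1+2*⌊n/2⌋ (suc (suc n)) =
  subst (2 + n ≤_) (cong suc (sym (*-suc 2 ⌊ n /2⌋))) (s≤s (s≤s (n≤1+2*⌊n/2⌋ n)))

snake-product : {β : ℕ → Subset n} {φ : ℕ → Subset M} → FacetPath n d b β → FacetPath M D a φ →
  ∃[ L ] ∃[ g ] (FacetPath (n + M) (d + D) L g × a * b ≤ 2 * L × b ≤ L)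
snake-product {b = b} {a = a} B F =
  L′ , lift B F ∘ snake , lift-path B F (snake-induced L′) inGrid , a*b≤2*L′ , m≤m+n b _
  where
  open Snake b
  k L′ : ℕ
  k = ⌊ a /2⌋
  L′ = b + k * (2 + b)

  inGrid : ∀ {t} → t ≤ L′ → InGrid B F (snake t)
  inGrid t≤L with snake-inGrid k t≤L
  ... | i≤b , j≤2k = i≤b , ≤-trans j≤2k (2*⌊n/2⌋≤n a)

  a*b≤2*L′ : a * b ≤ 2 * L′
  a*b≤2*L′ = begin
    a * b                         ≤⟨ *-monoˡ-≤ b (n≤1+2*⌊n/2⌋ a) ⟩
    suc (2 * k) * b               ≤⟨ m≤m+n _ (b + 4 * k) ⟩
    suc (2 * k) * b + (b + 4 * k) ≡⟨ expand k b ⟩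
    2 * L′                        ∎
    where
    open ≤-Reasoning
    expand : ∀ k b → suc (2 * k) * b + (b + 4 * k) ≡ 2 * (b + k * (2 + b))
    expand = solve-∀

point : FacetPath 0 0 0 (λ _ → [])
point = record
  { size          = λ _ → refl
  ; isInducedPath = record
    { adjacent             = λ ()
    ; adjacent⇒consecutive = λ _ _ ()
    ; injective            = λ { z≤n z≤n _ → refl }
    }
  }

snake-power : {β : ℕ → Subset n} → FacetPath n d h β → ∀ k →
  ∃[ L ] ∃[ g ] (FacetPath (suc k * n) (suc k * d) L g × h ^ suc k ≤ 2 ^ k * L)
-- The product with point only moves β onto 1 * n = n + 0 vertices.
snake-power {h = h} P zero with snake-product P point
... | L , g , Q , _ , h≤L = L , g , Q , subst₂ _≤_ (sym (*-identityʳ h)) (sym (*-identityˡ L)) h≤L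
snake-power {h = h} P (suc k) with snake-power P k
... | L , _ , Q , h^[1+k]≤2^k*L with snake-product P Q
...   | L′ , g′ , Q′ , L*h≤2*L′ , _ = L′ , g′ , Q′ , (begin
  h * h ^ suc k      ≤⟨ *-monoʳ-≤ h h^[1+k]≤2^k*L ⟩
  h * (2 ^ k * L)    ≡⟨ rotate h (2 ^ k) L ⟩
  2 ^ k * (L * h)    ≤⟨ *-monoʳ-≤ (2 ^ k) L*h≤2*L′ ⟩
  2 ^ k * (2 * L′)   ≡⟨ reassociate (2 ^ k) L′ ⟩
  2 ^ suc k * L′     ∎)
  where
  open ≤-Reasoning
  rotate : ∀ x y z → x * (y * z) ≡ y * (z * x)
  rotate = solve-∀
  reassociate : ∀ x y → x * (2 * y) ≡ 2 * x * y
  reassociate = solve-∀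

corollary2p11 : (n d k : ℕ) → 1 ≤ n → 1 ≤ d → 1 ≤ k → d ≤ n →
    (h h′ : ℕ) → IsHs n d h → IsHs (k * n) (k * d) h′ →
    h ^ k ≤ 2 ^ (k ∸ 1) * h′
corollary2p11 n d (suc k) _ _ _ _ h h′ ((_ , diameter) , _) (_ , maximal)
  with diametralPath diameter
... | _ , P with snake-power P k
...   | L , _ , Q , h^[1+k]≤2^k*L =
  ≤-trans h^[1+k]≤2^k*L (*-monoʳ-≤ (2 ^ k) (maximal (pathComplex Q) L (pathComplex-diameter Q)))
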